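{- Let $\mathbb{F}$ be a field, let $U \in \mathbb{F}^{n\times m}$ with $n \le m$ have full row rank $n$, and let $\Omega \subsetneq [n]$. If $S\subseteq[m]$ is a maximal $\Omega$-valid set, then $n-1\le |S|\le m-1$.
   Context: For $S\subseteq[m]$, $U_{:,S}$ denotes the submatrix of $U$ with columns indexed by $S$. For $\lambda\in\mathbb{F}^n$, $\mathrm{supp}(\lambda)=\{i:\lambda_i\neq 0\}$. A set $S\subseteq[m]$ is $\Omega$-valid if there exists $\lambda\in\mathbb{F}^n$ with $\mathrm{supp}(\lambda)\not\subseteq\Omega$ and $\lambda^T U_{:,S}=0$. An $\Omega$-valid set is maximal if it is not a proper subset of any other $\Omega$-valid set. -}

module Defs where

open import Level using (Level; _⊔_; suc)
open import Data.Nat.Base using (ℕ)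
open import Data.Fin.Base using (Fin)
open import Data.Fin.Subset using (Subset; _∈_; _∉_; _⊂_)
open import Data.Product using (Σ; ∃; _×_; _,_)
open import Algebra.Bundles using (CommutativeRing)
import Algebra.Properties.CommutativeMonoid.Sum as SumProps
open import Relation.Nullary using (¬_)

record Field (c ℓ : Level) : Set (suc (c ⊔ ℓ)) where
  field
    commutativeRing : CommutativeRing c ℓ
  open CommutativeRing commutativeRing public
  field
    1≉0     : ¬ (1# ≈ 0#)
    inverse : ∀ x → ¬ (x ≈ 0#) → Σ Carrier λ y → x * y ≈ 1#

module LinAlg {c ℓ : Level} (F : Field c ℓ) where
  open Field F
  open SumProps +-commutativeMonoid using (sum)

  Matrix : ℕ → ℕ → Set c
  Matrix n m = Fin n → Fin m → Carrier

  rowComb : ∀ {n m} → (Fin n → Carrier) → Matrix n m → Fin m → Carrier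
  rowComb {n} lam U j = sum (λ i → lam i * U i j)

  FullRowRank : ∀ {n m} → Matrix n m → Set (c ⊔ ℓ)
  FullRowRank {n} U = ∀ (lam : Fin n → Carrier) →
    (∀ j → rowComb lam U j ≈ 0#) → ∀ i → lam i ≈ 0#

  SuppNotSub : ∀ {n} → (Fin n → Carrier) → Subset n → Set ℓ
  SuppNotSub {n} lam Ω = Σ (Fin n) λ i → ¬ (lam i ≈ 0#) × i ∉ Ω

  Valid : ∀ {n m} → Matrix n m → Subset n → Subset m → Set (c ⊔ ℓ)
  Valid {n} U Ω S = Σ (Fin n → Carrier) λ lam →
    SuppNotSub lam Ω × (∀ j → j ∈ S → rowComb lam U j ≈ 0#)

  MaximalValid : ∀ {n m} → Matrix n m → Subset n → Subset m → Set (c ⊔ ℓ)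
  MaximalValid {n} {m} U Ω S =
    Valid U Ω S × (∀ (T : Subset m) → S ⊂ T → ¬ Valid U Ω T)

module Submission where

-- Upper bound: a valid set S cannot contain every column, since then the
-- witness λ ≠ 0 would satisfy λᵀU = 0, contradicting full row rank.
--
-- Lower bound: suppose |S| < n − 1 and λ witnesses validity with λᵢ ≠ 0,
-- i ∉ Ω.  Deleting row i leaves n − 1 > |S| rows, so the homogeneous system
-- yᵀ U_{−i,S} = 0 has a nonzero solution y (Gaussian elimination).  Padding y
-- with a zero at i gives μ ≠ 0 with μᵢ = 0 annihilating S; by full row rank
-- (μᵀU)ⱼ ≠ 0 for some column j, necessarily j ∉ S.  Then
-- ν = (μᵀU)ⱼ λ − (λᵀU)ⱼ μ annihilates S ∪ {j} and νᵢ = (μᵀU)ⱼ λᵢ ≠ 0, so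
-- S ∪ {j} is valid, contradicting maximality.
--
-- Equality in the field is not assumed decidable, so the case distinctions
-- (pivot or zero column, vanishing or not) are made inside the double-negation
-- monad; this suffices because both bounds are decidable statements about ℕ.

open import Defs
open import Level using (Level; _⊔_)
open import Data.Nat.Base using (ℕ; zero; suc; _≤_; _<_; _∸_; z≤n; s≤s)
open import Data.Nat.Properties
  using (_≤?_; ≰⇒>; m≤n⇒m≤1+n; <⇒≤pred; ≤-trans; ≤-reflexive; pred[m∸n]≡m∸[1+n])
open import Data.Fin.Base using (Fin; zero; suc; punchIn)
open import Data.Fin.Properties using (all?; ¬∀⟶∃¬)
open import Data.Fin.Subset using (Subset; _∈_; _∉_; _⊂_; _∪_; ⁅_⁆; ⊤; ∣_∣; inside; outside)
open import Data.Fin.Subset.Properties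
  using (_∈?_; x∈⁅x⁆; x∈⁅y⁆⇒x≡y; x∈p∪q⁻; x∈p∪q⁺; p⊆p∪q; ⊆⊤; ∈⊤; p⊂q⇒∣p∣<∣q∣; ∣⊤∣≡n)
open import Data.Vec.Base using ([]; _∷_; here; there)
open import Data.Vec.Functional using (insertAt)
open import Data.Vec.Functional.Properties using (insertAt-lookup; insertAt-punchIn)
open import Data.Product using (Σ; ∃; _×_; _,_; proj₁; proj₂)
open import Data.Sum using (_⊎_; inj₁; inj₂)
open import Data.Empty using (⊥)
open import Function using (_∘_; id)
open import Relation.Nullary using (¬_; yes; no)
open import Relation.Nullary.Negation using (DoubleNegation; ¬¬-map; negated-stable)
open import Relation.Nullary.Decidable using (decidable-stable; ¬¬-excluded-middle)
open import Relation.Unary using (Pred; Decidable)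
import Relation.Binary.PropositionalEquality as ≡

private
  variable
    a b p : Level
    A : Set a
    B : Set b

return : A → DoubleNegation A
return x ¬x = ¬x x

_>>=_ : DoubleNegation A → (A → DoubleNegation B) → DoubleNegation B
m >>= f = negated-stable (¬¬-map f m)

¬¬-decidable : ∀ {n} (P : Pred (Fin n) p) → DoubleNegation (Decidable P)
¬¬-decidable {n = zero} P = return λ ()
¬¬-decidable {n = suc n} P = do
  P₀? ← ¬¬-excluded-middle
  Pₛ? ← ¬¬-decidable (P ∘ suc)
  return λ { zero → P₀? ; (suc i) → Pₛ? i }

¬¬-dichotomy : ∀ {n} (P : Pred (Fin n) p) → DoubleNegation ((∀ i → P i) ⊎ ∃ λ i → ¬ P i)
¬¬-dichotomy P = ¬¬-map decide (¬¬-decidable P)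
  where
  decide : Decidable P → (∀ i → P i) ⊎ ∃ λ i → ¬ P i
  decide P? with all? P?
  ... | yes everywhere = inj₁ everywhere
  ... | no notEverywhere = inj₂ (¬∀⟶∃¬ _ P P? notEverywhere)

∣p∣<n : ∀ {n} (S : Subset n) → ¬ (∀ j → j ∈ S) → ∣ S ∣ < n
∣p∣<n {n} S notFull with ¬∀⟶∃¬ n (_∈ S) (_∈? S) notFull
... | j , j∉S = ≡.subst (∣ S ∣ <_) (∣⊤∣≡n n) (p⊂q⇒∣p∣<∣q∣ (⊆⊤ , j , ∈⊤ , j∉S))

p⊂p∪⁅x⁆ : ∀ {n} {S : Subset n} {j} → j ∉ S → S ⊂ S ∪ ⁅ j ⁆
p⊂p∪⁅x⁆ {j = j} j∉S = p⊆p∪q ⁅ j ⁆ , j , x∈p∪q⁺ (inj₂ (x∈⁅x⁆ j)) , j∉S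

module LinearAlgebra {c ℓ : Level} (F : Field c ℓ) where
  open Field F hiding (zero)
  open LinAlg F
  open import Algebra.Properties.Semiring.Sum semiring
    using (sum; sum-cong-≋; sum-replicate-zero; ∑-distrib-+; sum-remove; sum-cong-≗;
           *-distribˡ-sum; *-distribʳ-sum)
  open import Algebra.Properties.Ring ring using (-‿distribˡ-*; x[y-z]≈xy-xz; [y-z]x≈yx-zx)
  open import Algebra.Properties.AbelianGroup +-abelianGroup using (⁻¹-∙-comm; ε⁻¹≈ε; x≈y⇒x∙y⁻¹≈ε)
  open import Relation.Binary.Reasoning.Setoid setoid

  *-nonzero : ∀ {x y} → ¬ x ≈ 0# → ¬ y ≈ 0# → ¬ x * y ≈ 0#
  *-nonzero {x} {y} x≉0 y≉0 xy≈0 = y≉0 (begin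
    y             ≈⟨ sym (*-identityˡ y) ⟩
    1# * y        ≈⟨ *-congʳ (sym (trans (*-comm x⁻¹ x) x*x⁻¹≈1)) ⟩
    x⁻¹ * x * y   ≈⟨ *-assoc x⁻¹ x y ⟩
    x⁻¹ * (x * y) ≈⟨ *-congˡ xy≈0 ⟩
    x⁻¹ * 0#      ≈⟨ zeroʳ x⁻¹ ⟩
    0#            ∎)
    where
    x⁻¹ : Carrier
    x⁻¹ = proj₁ (inverse x x≉0)
    x*x⁻¹≈1 : x * x⁻¹ ≈ 1#
    x*x⁻¹≈1 = proj₂ (inverse x x≉0)

  sum-zero : ∀ {n} (f : Fin n → Carrier) → (∀ i → f i ≈ 0#) → sum f ≈ 0#
  sum-zero {n} f f≈0 = trans (sum-cong-≋ f≈0) (sum-replicate-zero n)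

  sum-neg : ∀ {n} (f : Fin n → Carrier) → sum (λ i → - f i) ≈ - sum f
  sum-neg {zero} f = sym ε⁻¹≈ε
  sum-neg {suc n} f = trans (+-congˡ (sum-neg (f ∘ suc))) (⁻¹-∙-comm (f zero) (sum (f ∘ suc)))

  sum-sub : ∀ {n} (f g : Fin n → Carrier) → sum (λ i → f i - g i) ≈ sum f - sum g
  sum-sub f g = trans (∑-distrib-+ f (λ i → - g i)) (+-congˡ (sum-neg g))

  deleteRow : ∀ {n m} → Fin (suc n) → Matrix (suc n) m → Matrix n m
  deleteRow i U k j = U (punchIn i k) j

  dropFirstColumn : ∀ {n m} → Matrix n (suc m) → Matrix n m
  dropFirstColumn U k j = U k (suc j)

  Annihilates : ∀ {n m} → Matrix n m → (Fin n → Carrier) → Subset m → Set ℓ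
  Annihilates U x S = ∀ j → j ∈ S → rowComb x U j ≈ 0#

  Annihilator : ∀ {n m} → Matrix n m → Subset m → Set (c ⊔ ℓ)
  Annihilator {n} U S = Σ (Fin n → Carrier) λ x → (∃ λ k → ¬ x k ≈ 0#) × Annihilates U x S

  rowComb-linear : ∀ {n m} (U : Matrix n m) (α β : Carrier) (x y : Fin n → Carrier) j →
    rowComb (λ k → α * x k - β * y k) U j ≈ α * rowComb x U j - β * rowComb y U j
  rowComb-linear U α β x y j = begin
    sum (λ k → (α * x k - β * y k) * U k j)
      ≈⟨ sum-cong-≋ expand ⟩
    sum (λ k → α * (x k * U k j) - β * (y k * U k j))
      ≈⟨ sum-sub (λ k → α * (x k * U k j)) (λ k → β * (y k * U k j)) ⟩
    sum (λ k → α * (x k * U k j)) - sum (λ k → β * (y k * U k j))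
      ≈⟨ sym (+-cong (*-distribˡ-sum α (λ k → x k * U k j))
                     (-‿cong (*-distribˡ-sum β (λ k → y k * U k j)))) ⟩
    α * rowComb x U j - β * rowComb y U j ∎
    where
    expand : ∀ k → (α * x k - β * y k) * U k j ≈ α * (x k * U k j) - β * (y k * U k j)
    expand k = trans ([y-z]x≈yx-zx (U k j) (α * x k) (β * y k))
                     (+-cong (*-assoc α (x k) (U k j)) (-‿cong (*-assoc β (y k) (U k j))))

  rowComb-rankOneUpdate : ∀ {n m} (x : Fin n → Carrier) (A : Matrix n m) (w : Fin n → Carrier)
    (d : Fin m → Carrier) j →
    rowComb x (λ k j → A k j - w k * d j) j ≈ rowComb x A j - sum (λ k → x k * w k) * d j
  rowComb-rankOneUpdate x A w d j = begin
    sum (λ k → x k * (A k j - w k * d j))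
      ≈⟨ sum-cong-≋ (λ k → trans (x[y-z]≈xy-xz (x k) (A k j) (w k * d j))
                                  (+-congˡ (-‿cong (sym (*-assoc (x k) (w k) (d j)))))) ⟩
    sum (λ k → x k * A k j - x k * w k * d j)
      ≈⟨ sum-sub (λ k → x k * A k j) (λ k → x k * w k * d j) ⟩
    rowComb x A j - sum (λ k → x k * w k * d j)
      ≈⟨ +-congˡ (-‿cong (sym (*-distribʳ-sum (d j) (λ k → x k * w k)))) ⟩
    rowComb x A j - sum (λ k → x k * w k) * d j ∎

  rowComb-insertAt : ∀ {n m} (U : Matrix (suc n) m) (y : Fin n → Carrier) i v j →
    rowComb (insertAt y i v) U j ≈ v * U i j + rowComb y (deleteRow i U) j
  rowComb-insertAt U y i v j =
    trans (sum-remove {i = i} (λ k → insertAt y i v k * U k j))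
          (+-cong (reflexive (≡.cong (_* U i j) (insertAt-lookup y i v)))
                  (reflexive (sum-cong-≗ λ k → ≡.cong (_* U (punchIn i k) j) (insertAt-punchIn y i v k))))

  rowComb-padZero : ∀ {n m} (U : Matrix (suc n) m) (y : Fin n → Carrier) i j →
    rowComb (insertAt y i 0#) U j ≈ rowComb y (deleteRow i U) j
  rowComb-padZero U y i j =
    trans (rowComb-insertAt U y i 0# j) (trans (+-congʳ (zeroˡ (U i j))) (+-identityˡ _))

  annihilator-outside : ∀ {n m} {W : Matrix n (suc m)} {S} →
    Annihilator (dropFirstColumn W) S → Annihilator W (outside ∷ S)
  annihilator-outside (x , x≉0 , x-ann) = x , x≉0 , λ { zero () ; (suc j) (there j∈S) → x-ann j j∈S }

  annihilator-zeroColumn : ∀ {n m} {W : Matrix n (suc m)} {S} → (∀ i → W i zero ≈ 0#) →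
    Annihilator (dropFirstColumn W) S → Annihilator W (inside ∷ S)
  annihilator-zeroColumn zeroColumn (x , x≉0 , x-ann) = x , x≉0 , λ
    { zero here → sum-zero _ (λ i → trans (*-congˡ (zeroColumn i)) (zeroʳ (x i)))
    ; (suc j) (there j∈S) → x-ann j j∈S }

  -- One step of Gaussian elimination with pivot W i₀ 0 of inverse α: delete row i₀
  -- and column 0, subtracting from every other row its multiple of row i₀.
  eliminate : ∀ {n m} → Matrix (suc n) (suc m) → Fin (suc n) → Carrier → Matrix n m
  eliminate W i₀ α k j = W (punchIn i₀ k) (suc j) - W (punchIn i₀ k) zero * (α * W i₀ (suc j))

  -- Back substitution: an annihilator y of the reduced matrix lifts to W by choosing
  -- the pivot coordinate −(yᵀw) α, where w is column 0 without row i₀.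
  annihilator-pivot : ∀ {n m} {W : Matrix (suc n) (suc m)} {S} {i₀ α} → W i₀ zero * α ≈ 1# →
    Annihilator (eliminate W i₀ α) S → Annihilator W (inside ∷ S)
  annihilator-pivot {n} {W = W} {S} {i₀} {α} pivot*α≈1 (y , (k , yₖ≉0) , y-ann) =
    x , (punchIn i₀ k , yₖ≉0 ∘ trans (reflexive (≡.sym (insertAt-punchIn y i₀ _ k)))) , x-ann
    where
    t : Carrier
    t = sum (λ k → y k * W (punchIn i₀ k) zero)
    x : Fin (suc n) → Carrier
    x = insertAt y i₀ (- (t * α))

    x-ann : Annihilates W x (inside ∷ S)
    x-ann zero here = begin
      rowComb x W zero                   ≈⟨ rowComb-insertAt W y i₀ _ zero ⟩
      - (t * α) * W i₀ zero + t          ≈⟨ +-congʳ (sym (-‿distribˡ-* (t * α) (W i₀ zero))) ⟩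
      - (t * α * W i₀ zero) + t          ≈⟨ +-congʳ (-‿cong (*-assoc t α (W i₀ zero))) ⟩
      - (t * (α * W i₀ zero)) + t        ≈⟨ +-congʳ (-‿cong (*-congˡ (trans (*-comm α _) pivot*α≈1))) ⟩
      - (t * 1#) + t                     ≈⟨ +-congʳ (-‿cong (*-identityʳ t)) ⟩
      - t + t                            ≈⟨ -‿inverseˡ t ⟩
      0#                                 ∎
    x-ann (suc j) (there j∈S) = begin
      rowComb x W (suc j)
        ≈⟨ rowComb-insertAt W y i₀ _ (suc j) ⟩
      - (t * α) * W i₀ (suc j) + rowComb y (deleteRow i₀ W) (suc j)
        ≈⟨ +-comm _ _ ⟩
      rowComb y (deleteRow i₀ W) (suc j) + - (t * α) * W i₀ (suc j)
        ≈⟨ +-congˡ (trans (sym (-‿distribˡ-* (t * α) _)) (-‿cong (*-assoc t α _))) ⟩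
      rowComb y (deleteRow i₀ W) (suc j) - t * (α * W i₀ (suc j))
        ≈⟨ sym (rowComb-rankOneUpdate y (deleteRow i₀ (dropFirstColumn W))
                  (λ k → W (punchIn i₀ k) zero) (λ j → α * W i₀ (suc j)) j) ⟩
      rowComb y (eliminate W i₀ α) j
        ≈⟨ y-ann j j∈S ⟩
      0# ∎

  underdetermined : ∀ {n m} (W : Matrix n m) (S : Subset m) → ∣ S ∣ < n →
    DoubleNegation (Annihilator W S)
  underdetermined {suc n} {zero} W [] _ = return ((λ _ → 1#) , (zero , 1≉0) , λ _ ())
  underdetermined W (outside ∷ S) lt =
    ¬¬-map annihilator-outside (underdetermined (dropFirstColumn W) S lt)
  underdetermined {suc n} W (inside ∷ S) (s≤s lt) =
    ¬¬-dichotomy (λ i → W i zero ≈ 0#) >>= byFirstColumn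
    where
    byFirstColumn : (∀ i → W i zero ≈ 0#) ⊎ (∃ λ i → ¬ W i zero ≈ 0#) →
      DoubleNegation (Annihilator W (inside ∷ S))
    byFirstColumn (inj₁ zeroColumn) =
      ¬¬-map (annihilator-zeroColumn {W = W} {S} zeroColumn)
             (underdetermined (dropFirstColumn W) S (m≤n⇒m≤1+n lt))
    byFirstColumn (inj₂ (i₀ , pivot≉0)) =
      ¬¬-map (annihilator-pivot {W = W} {S} {i₀} {α} pivot*α≈1)
             (underdetermined (eliminate W i₀ α) S lt)
      where
      α : Carrier
      α = proj₁ (inverse (W i₀ zero) pivot≉0)
      pivot*α≈1 : W i₀ zero * α ≈ 1#
      pivot*α≈1 = proj₂ (inverse (W i₀ zero) pivot≉0)

  combination-annihilates : ∀ {n m} (U : Matrix n m) {S} (lam μ : Fin n → Carrier) j →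
    Annihilates U lam S → Annihilates U μ S →
    Annihilates U (λ k → rowComb μ U j * lam k - rowComb lam U j * μ k) (S ∪ ⁅ j ⁆)
  combination-annihilates U {S} lam μ j lam-ann μ-ann j′ j′∈S∪j =
    trans (rowComb-linear U μUⱼ λUⱼ lam μ j′) (vanishes (x∈p∪q⁻ S ⁅ j ⁆ j′∈S∪j))
    where
    μUⱼ λUⱼ : Carrier
    μUⱼ = rowComb μ U j
    λUⱼ = rowComb lam U j
    vanishes : j′ ∈ S ⊎ j′ ∈ ⁅ j ⁆ → μUⱼ * rowComb lam U j′ - λUⱼ * rowComb μ U j′ ≈ 0#
    vanishes (inj₁ j′∈S) = begin
      μUⱼ * rowComb lam U j′ - λUⱼ * rowComb μ U j′
        ≈⟨ +-cong (*-congˡ (lam-ann j′ j′∈S)) (-‿cong (*-congˡ (μ-ann j′ j′∈S))) ⟩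
      μUⱼ * 0# - λUⱼ * 0#
        ≈⟨ +-cong (zeroʳ μUⱼ) (-‿cong (zeroʳ λUⱼ)) ⟩
      0# - 0#
        ≈⟨ x≈y⇒x∙y⁻¹≈ε refl ⟩
      0# ∎
    vanishes (inj₂ j′∈⁅j⁆) rewrite x∈⁅y⁆⇒x≡y j j′∈⁅j⁆ = x≈y⇒x∙y⁻¹≈ε (*-comm μUⱼ λUⱼ)

  valid-extend : ∀ {n m} (U : Matrix n m) {Ω S} (lam : Fin n → Carrier) i →
    ¬ lam i ≈ 0# → i ∉ Ω → Annihilates U lam S →
    (μ : Fin n → Carrier) → μ i ≈ 0# → Annihilates U μ S →
    ∀ j → ¬ rowComb μ U j ≈ 0# → Valid U Ω (S ∪ ⁅ j ⁆)
  valid-extend {n} U lam i lamᵢ≉0 i∉Ω lam-ann μ μᵢ≈0 μ-ann j μUⱼ≉0 =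
    ν , (i , νᵢ≉0 , i∉Ω) , combination-annihilates U lam μ j lam-ann μ-ann
    where
    ν : Fin n → Carrier
    ν = λ k → rowComb μ U j * lam k - rowComb lam U j * μ k
    νᵢ≈μUⱼλᵢ : ν i ≈ rowComb μ U j * lam i
    νᵢ≈μUⱼλᵢ = begin
      rowComb μ U j * lam i - rowComb lam U j * μ i ≈⟨ +-congˡ (-‿cong (*-congˡ μᵢ≈0)) ⟩
      rowComb μ U j * lam i - rowComb lam U j * 0#  ≈⟨ +-congˡ (-‿cong (zeroʳ _)) ⟩
      rowComb μ U j * lam i - 0#                    ≈⟨ +-congˡ ε⁻¹≈ε ⟩
      rowComb μ U j * lam i + 0#                    ≈⟨ +-identityʳ _ ⟩
      rowComb μ U j * lam i                         ∎
    νᵢ≉0 : ¬ ν i ≈ 0#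
    νᵢ≉0 = *-nonzero μUⱼ≉0 lamᵢ≉0 ∘ trans (sym νᵢ≈μUⱼλᵢ)

  valid-missesColumn : ∀ {n m} (U : Matrix n m) → FullRowRank U → ∀ {Ω S} →
    Valid U Ω S → ¬ (∀ j → j ∈ S)
  valid-missesColumn U fullRank (lam , (i , lamᵢ≉0 , _) , lam-ann) allIn =
    lamᵢ≉0 (fullRank lam (λ j → lam-ann j (allIn j)) i)

  maximalValid-notSmall : ∀ {n m} (U : Matrix (suc n) m) → FullRowRank U → ∀ {Ω S} →
    MaximalValid U Ω S → ¬ ∣ S ∣ < n
  maximalValid-notSmall U fullRank {S = S} ((lam , (i , lamᵢ≉0 , i∉Ω) , lam-ann) , maximal) lt =
    refutation id
    where
    refutation : DoubleNegation ⊥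
    refutation = do
      y , (k , yₖ≉0) , y-ann ← underdetermined (deleteRow i U) S lt
      let μ = insertAt y i 0#
          μ-ann : Annihilates U μ S
          μ-ann j j∈S = trans (rowComb-padZero U y i j) (y-ann j j∈S)
          μᵢ≈0 : μ i ≈ 0#
          μᵢ≈0 = reflexive (insertAt-lookup y i 0#)
          μ-nonzero : ¬ (∀ j → rowComb μ U j ≈ 0#)
          μ-nonzero μU≈0 = yₖ≉0 (trans (reflexive (≡.sym (insertAt-punchIn y i 0# k)))
                                       (fullRank μ μU≈0 (punchIn i k)))
      inj₂ (j , μUⱼ≉0) ← ¬¬-dichotomy (λ j → rowComb μ U j ≈ 0#)
        where inj₁ μU≈0 → return (μ-nonzero μU≈0)
      return (maximal (S ∪ ⁅ j ⁆) (p⊂p∪⁅x⁆ (μUⱼ≉0 ∘ μ-ann j))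
                      (valid-extend U lam i lamᵢ≉0 i∉Ω lam-ann μ μᵢ≈0 μ-ann j μUⱼ≉0))

  maximalValid-lowerBound : ∀ {n m} (U : Matrix n m) → FullRowRank U → ∀ {Ω S} →
    MaximalValid U Ω S → n ∸ 1 ≤ ∣ S ∣
  maximalValid-lowerBound {zero} _ _ _ = z≤n
  maximalValid-lowerBound {suc n} U fullRank {S = S} maxValid =
    decidable-stable (n ≤? ∣ S ∣) (maximalValid-notSmall U fullRank maxValid ∘ ≰⇒>)

  maximalValid-upperBound : ∀ {n m} (U : Matrix n m) → FullRowRank U → ∀ {Ω S} →
    MaximalValid U Ω S → ∣ S ∣ ≤ m ∸ 1
  maximalValid-upperBound {m = m} U fullRank {S = S} (valid , _) =
    ≤-trans (<⇒≤pred (∣p∣<n S (valid-missesColumn U fullRank valid)))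
            (≤-reflexive (pred[m∸n]≡m∸[1+n] m 0))

mainTheorem13 : ∀ {c ℓ : Level} (F : Field c ℓ) (n m : ℕ) →
    n ≤ m →
    (U : LinAlg.Matrix F n m) → LinAlg.FullRowRank F U →
    (Ω : Subset n) → Ω ⊂ ⊤ →
    (S : Subset m) → LinAlg.MaximalValid F U Ω S →
    (n ∸ 1 ≤ ∣ S ∣) × (∣ S ∣ ≤ m ∸ 1)
mainTheorem13 F n m _ U fullRank Ω _ S maxValid =
  maximalValid-lowerBound U fullRank maxValid , maximalValid-upperBound U fullRank maxValid
  where open LinearAlgebra F
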